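{- Let $d_1,d_2\ge1$, $C_1\in\mathrm{GL}_{d_1}(\overline{\mathbb{Q}})$, $C_2\in\mathrm{GL}_{d_2}(\overline{\mathbb{Q}})$, and $B\in M_{d_1,d_2}(\mathcal{P})$ whose entries have positive $z$-adic valuation. Then there exists $M\in M_{d_1,d_2}(\mathcal{P})$ such that $C_1M-\phi_p(M)C_2=B$.
   Context: Fix an integer $p\ge2$. $\overline{\mathbb{Q}}$ is the field of algebraic numbers; $\mathcal{P}=\bigcup_{k\ge1}\overline{\mathbb{Q}}((z^{1/k}))$ is the field of Puiseux series; $\phi_p$ is the automorphism of $\mathcal{P}$ with $\phi_p(\sum f_\gamma z^\gamma)=\sum f_\gamma z^{p\gamma}$, applied entrywise to matrices. $M_{m,n}(E)$ denotes $m\times n$ matrices with entries in $E$. -}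

module Defs where

open import Level using (Level; _⊔_)
open import Algebra.Bundles using (CommutativeRing)
open import Data.Nat as ℕ using (ℕ; zero; suc; NonZero)
open import Data.Nat.Divisibility using (_∣_)
open import Data.Integer as ℤ using (ℤ; +_; -[1+_])
open import Data.Rational as ℚ using (ℚ; 0ℚ; ↧ₙ_)
open import Data.Fin using (Fin; _≟_)
open import Data.List using (List; []; _∷_; map)
open import Data.List.Relation.Unary.Any using (Any)
open import Data.Product using (Σ; ∃; _×_)
open import Relation.Nullary using (¬_; yes; no)
open import Relation.Binary.PropositionalEquality using (_≡_)

module RingOps {c ℓ} (R : CommutativeRing c ℓ) where
  open CommutativeRing R

  eval : List Carrier → Carrier → Carrier
  eval []       x = 0#
  eval (a ∷ as) x = a + x * eval as x

  -- x ↦ xⁿ with leading 1 : the monic polynomial a₀ + a₁ x + … + a_{n-1} x^{n-1} + xⁿ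
  evalMonic : List Carrier → Carrier → Carrier
  evalMonic []       x = 1#
  evalMonic (a ∷ as) x = a + x * evalMonic as x

  fromℕ : ℕ → Carrier
  fromℕ zero    = 0#
  fromℕ (suc n) = 1# + fromℕ n

  fromℤ : ℤ → Carrier
  fromℤ (+ n)     = fromℕ n
  fromℤ -[1+ n ]  = - fromℕ (suc n)

-- A model of the field of algebraic numbers ℚ̄ : an algebraically closed field of
-- characteristic 0 that is algebraic over ℚ (unique up to isomorphism).
record AlgebraicClosureOfℚ (c ℓ : Level) : Set (Level.suc (c ⊔ ℓ)) where
  field
    commRing : CommutativeRing c ℓ
  open CommutativeRing commRing public
  open RingOps commRing public
  field
    nontrivial : ¬ (1# ≈ 0#)
    inverse    : ∀ x → ¬ (x ≈ 0#) → ∃ λ y → x * y ≈ 1#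
    char0      : ∀ n → ¬ (fromℕ (suc n) ≈ 0#)
    algClosed  : ∀ (a : Carrier) (as : List Carrier) → ∃ λ x → evalMonic (a ∷ as) x ≈ 0#
    algebraic  : ∀ x → ∃ λ (cs : List ℤ) → Any (λ k → ¬ (k ≡ + 0)) cs × (eval (map fromℤ cs) x ≈ 0#)

module Over {c ℓ} (K : AlgebraicClosureOfℚ c ℓ) where
  open AlgebraicClosureOfℚ K

  Mat : ℕ → ℕ → Set c
  Mat m n = Fin m → Fin n → Carrier

  Σ[_]_ : (n : ℕ) → (Fin n → Carrier) → Carrier
  Σ[ zero  ] f = 0#
  Σ[ suc n ] f = f Data.Fin.zero + Σ[ n ] (λ i → f (Data.Fin.suc i))

  δ : ∀ {n} → Fin n → Fin n → Carrier
  δ i j with i ≟ j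
  ... | yes _ = 1#
  ... | no  _ = 0#

  IsInvertible : ∀ {n} → Mat n n → Set (c ⊔ ℓ)
  IsInvertible {n} C = ∃ λ (D : Mat n n) →
      (∀ i j → Σ[ n ] (λ l → C i l * D l j) ≈ δ i j)
    × (∀ i j → Σ[ n ] (λ l → D i l * C l j) ≈ δ i j)

  -- A (generalized) series Σ_{γ ∈ ℚ} f(γ) z^γ is represented by its coefficient function f.
  -- It is a Puiseux series (an element of ⋃_{k≥1} K((z^{1/k}))) iff its support lies in
  -- (1/k)ℤ for some k ≥ 1 and is bounded below.
  Coeffs : Set c
  Coeffs = ℚ → Carrier

  IsPuiseux : Coeffs → Set ℓ
  IsPuiseux f =
      (∃ λ (k : ℕ) → ∀ q → ¬ (↧ₙ q ∣ suc k) → f q ≈ 0#)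
    × (∃ λ (v : ℚ) → ∀ q → q ℚ.< v → f q ≈ 0#)

  PosVal : Coeffs → Set ℓ
  PosVal f = ∀ q → q ℚ.≤ 0ℚ → f q ≈ 0#

  -- φ_p (Σ f_γ z^γ) = Σ f_γ z^{pγ}, i.e. coefficient at γ of φ_p f is f(γ/p)
  φ : (p : ℕ) → .{{NonZero p}} → Coeffs → Coeffs
  φ p f q = f (q ℚ.* (+ 1 ℚ./ p))

  -- (C₁ M - φ_p(M) C₂)_{ij}, coefficientwise (series addition / scalar multiplication are coefficientwise)
  twisted : ∀ {d₁ d₂} (p : ℕ) → .{{NonZero p}} → Mat d₁ d₁ → Mat d₂ d₂ →
            (Fin d₁ → Fin d₂ → Coeffs) → Fin d₁ → Fin d₂ → Coeffs
  twisted {d₁} {d₂} p C₁ C₂ M i j q =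
    Σ[ d₁ ] (λ l → C₁ i l * M l j q) - Σ[ d₂ ] (λ l → φ p (M i l) q * C₂ l j)

module Submission where

-- Comparing coefficients of z^q, the equation C₁ M − φ_p(M) C₂ = B reads
-- M(q) = C₁⁻¹ (B(q) + M(q/p) C₂), which unfolds to the sum over m of C₁^{-(m+1)} B(q/pᵐ) C₂ᵐ.
-- This sum is finite: B(q/pᵐ) vanishes when q ≤ 0 by positive valuation, and when q > 0 the
-- denominator of q/pᵐ grows like pᵐ, so for large m it no longer divides the common
-- ramification index of the entries of B. Since the denominator of q divides that of q/pᵐ,
-- the same two facts show that M is again a matrix of Puiseux series.

open import Algebra.Bundles using (Semiring)
import Algebra.Properties.Group as GroupProperties
import Algebra.Properties.Semiring.Sum as SemiringSum
open import Data.Fin using (Fin; zero; suc; punchIn; _≟_)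
open import Data.Fin.Properties using (punchInᵢ≢i)
open import Data.Integer as ℤ using (+_)
import Data.Integer.Properties as ℤ
open import Data.List using ([]; _∷_)
open import Data.Nat as ℕ using (ℕ; zero; suc; NonZero; _≤_; _<_; z≤n; s≤s; _^_)
import Data.Nat.Properties as ℕ
open import Data.Nat.Coprimality using (Coprime; coprime?; coprime-divisor; 1-coprimeTo)
import Data.Nat.Coprimality as Coprimality
open import Data.Nat.Divisibility using (_∣_; ∣-trans; ∣⇒≤; m∣m*n; n∣m*n)
open import Data.Nat.GeneralisedArithmetic using (iterate)
open import Data.Nat.Tactic.RingSolver using (solve)
open import Data.Product using (∃; _×_; _,_; proj₁; proj₂)
open import Data.Rational as ℚ using (ℚ; mkℚ; 0ℚ; ↥_; ↧_; ↧ₙ_)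
import Data.Rational.Properties as ℚₚ
import Data.Rational.Unnormalised as ℚᵘ
import Data.Vec.Functional.Relation.Binary.Equality.Setoid as VecEquality
open import Function using (_∘_)
open import Relation.Binary.Bundles using (Setoid)
open import Relation.Binary.PropositionalEquality as ≡ using (_≡_; _≢_; cong; subst; module ≡-Reasoning)
open import Relation.Nullary using (¬_; yes; no; contradiction)
open import Relation.Nullary.Decidable using (recompute)

open import Defs

n<m^n : ∀ {m} → 1 < m → ∀ n → n < m ^ n
n<m^n 1<m zero    = s≤s z≤n
n<m^n 1<m (suc n) = ℕ.≤-<-trans (n<m^n 1<m n) (ℕ.^-monoʳ-< _ 1<m (ℕ.n<1+n n))

common-multiple : ∀ {n} (k : Fin n → ℕ) → ∃ λ K → ∀ i → suc (k i) ∣ suc K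
common-multiple {zero}  k = 0 , λ ()
common-multiple {suc n} k with common-multiple (k ∘ suc)
... | K , k∣K = K ℕ.+ k zero ℕ.* suc K , λ where
  zero    → m∣m*n (suc K)
  (suc i) → ∣-trans (k∣K i) (n∣m*n (suc (k zero)))

*-cross-trans : ∀ {a₀ b₀ a₁ b₁ a₂ b₂} c d .{{_ : NonZero b₁}} →
                a₁ ℕ.* (b₀ ℕ.* c) ≡ a₀ ℕ.* b₁ → a₂ ℕ.* (b₁ ℕ.* d) ≡ a₁ ℕ.* b₂ →
                a₂ ℕ.* (b₀ ℕ.* (c ℕ.* d)) ≡ a₀ ℕ.* b₂
*-cross-trans {a₀} {b₀} {a₁} {b₁} {a₂} {b₂} c d e₁ e₂ = ℕ.*-cancelʳ-≡ _ _ b₁ (begin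
  a₂ * (b₀ * (c * d)) * b₁  ≡⟨ solve (a₂ ∷ b₀ ∷ c ∷ d ∷ b₁ ∷ []) ⟩
  a₂ * (b₁ * d) * (b₀ * c)  ≡⟨ cong (_* (b₀ * c)) e₂ ⟩
  a₁ * b₂ * (b₀ * c)        ≡⟨ solve (a₁ ∷ b₂ ∷ b₀ ∷ c ∷ []) ⟩
  a₁ * (b₀ * c) * b₂        ≡⟨ cong (_* b₂) e₁ ⟩
  a₀ * b₁ * b₂              ≡⟨ solve (a₀ ∷ b₁ ∷ b₂ ∷ []) ⟩
  a₀ * b₂ * b₁              ∎)
  where open ≡-Reasoning; open import Data.Nat.Base using (_*_)

∣↥∣-*-↧ₙ : ∀ x y → ℤ.∣ ↥ (x ℚ.* y) ∣ ℕ.* (↧ₙ x ℕ.* ↧ₙ y) ≡ ℤ.∣ ↥ x ∣ ℕ.* ℤ.∣ ↥ y ∣ ℕ.* ↧ₙ (x ℚ.* y)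
∣↥∣-*-↧ₙ x@record{} y@record{} with x ℚ.* y | ℚₚ.toℚᵘ-homo-* x y
... | z@(mkℚ n _ _) | ℚᵘ.*≡* e = begin
  ℤ.∣ n ∣ ℕ.* (↧ₙ x ℕ.* ↧ₙ y)              ≡⟨ ℤ.abs-* n (↧ x ℤ.* ↧ y) ⟨
  ℤ.∣ n ℤ.* (↧ x ℤ.* ↧ y) ∣                ≡⟨ cong ℤ.∣_∣ e ⟩
  ℤ.∣ ↥ x ℤ.* ↥ y ℤ.* ↧ z ∣                ≡⟨ ℤ.abs-* (↥ x ℤ.* ↥ y) (↧ z) ⟩
  ℤ.∣ ↥ x ℤ.* ↥ y ∣ ℕ.* ↧ₙ z               ≡⟨ cong (ℕ._* ↧ₙ z) (ℤ.abs-* (↥ x) (↥ y)) ⟩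
  ℤ.∣ ↥ x ∣ ℕ.* ℤ.∣ ↥ y ∣ ℕ.* ↧ₙ z         ∎
  where open ≡-Reasoning

↥[1/n] : ∀ n .{{_ : NonZero n}} → ↥ (+ 1 ℚ./ n) ≡ + 1
↥[1/n] (suc n) rewrite ℚₚ.normalize-coprime (1-coprimeTo (suc n)) = ≡.refl

↧ₙ[1/n] : ∀ n .{{_ : NonZero n}} → ↧ₙ (+ 1 ℚ./ n) ≡ n
↧ₙ[1/n] (suc n) rewrite ℚₚ.normalize-coprime (1-coprimeTo (suc n)) = ≡.refl

pos⇒∣↥∣>0 : ∀ {x} → ¬ x ℚ.≤ 0ℚ → 0 < ℤ.∣ ↥ x ∣
pos⇒∣↥∣>0 {mkℚ (+ zero)  _ _} x≰0 = contradiction (ℚ.*≤* (ℤ.+≤+ z≤n)) x≰0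
pos⇒∣↥∣>0 {mkℚ ℤ.+[1+ _ ] _ _} _ = s≤s z≤n
pos⇒∣↥∣>0 {mkℚ ℤ.-[1+ _ ] _ _} _ = s≤s z≤n

∣↥∣-coprime-↧ₙ : ∀ x → Coprime ℤ.∣ ↥ x ∣ (↧ₙ x)
∣↥∣-coprime-↧ₙ (mkℚ _ _ c) = recompute (coprime? _ _) c

module DivisionByPower (p : ℕ) .{{_ : NonZero p}} where

  infixl 7 _/p _/p^_

  _/p : ℚ → ℚ
  q /p = q ℚ.* (+ 1 ℚ./ p)

  _/p^_ : ℚ → ℕ → ℚ
  q /p^ m = iterate _/p q m

  ∣↥∣-/p : ∀ q → ℤ.∣ ↥ (q /p) ∣ ℕ.* (↧ₙ q ℕ.* p) ≡ ℤ.∣ ↥ q ∣ ℕ.* ↧ₙ (q /p)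
  ∣↥∣-/p q = begin
    ℤ.∣ ↥ (q /p) ∣ ℕ.* (↧ₙ q ℕ.* p)
      ≡⟨ cong (λ d → ℤ.∣ ↥ (q /p) ∣ ℕ.* (↧ₙ q ℕ.* d)) (↧ₙ[1/n] p) ⟨
    ℤ.∣ ↥ (q /p) ∣ ℕ.* (↧ₙ q ℕ.* ↧ₙ (+ 1 ℚ./ p))
      ≡⟨ ∣↥∣-*-↧ₙ q (+ 1 ℚ./ p) ⟩
    ℤ.∣ ↥ q ∣ ℕ.* ℤ.∣ ↥ (+ 1 ℚ./ p) ∣ ℕ.* ↧ₙ (q /p)
      ≡⟨ cong (λ a → ℤ.∣ ↥ q ∣ ℕ.* ℤ.∣ a ∣ ℕ.* ↧ₙ (q /p)) (↥[1/n] p) ⟩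
    ℤ.∣ ↥ q ∣ ℕ.* 1 ℕ.* ↧ₙ (q /p)
      ≡⟨ cong (ℕ._* ↧ₙ (q /p)) (ℕ.*-identityʳ ℤ.∣ ↥ q ∣) ⟩
    ℤ.∣ ↥ q ∣ ℕ.* ↧ₙ (q /p)
      ∎
    where open ≡-Reasoning

  ∣↥∣-/p^ : ∀ m q → ℤ.∣ ↥ (q /p^ m) ∣ ℕ.* (↧ₙ q ℕ.* p ^ m) ≡ ℤ.∣ ↥ q ∣ ℕ.* ↧ₙ (q /p^ m)
  ∣↥∣-/p^ zero    q = cong (ℤ.∣ ↥ q ∣ ℕ.*_) (ℕ.*-identityʳ (↧ₙ q))
  ∣↥∣-/p^ (suc m) q = *-cross-trans
    {ℤ.∣ ↥ q ∣} {↧ₙ q} {ℤ.∣ ↥ (q /p) ∣} {↧ₙ (q /p)} {ℤ.∣ ↥ (q /p^ suc m) ∣} {↧ₙ (q /p^ suc m)}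
    p (p ^ m) (∣↥∣-/p q) (∣↥∣-/p^ m (q /p))

  ↧ₙ∣↧ₙ-/p^ : ∀ m q → ↧ₙ q ∣ ↧ₙ (q /p^ m)
  ↧ₙ∣↧ₙ-/p^ m q = coprime-divisor coprime (subst (↧ₙ q ∣_) (∣↥∣-/p^ m q)
    (∣-trans (m∣m*n (p ^ m)) (n∣m*n ℤ.∣ ↥ (q /p^ m) ∣)))
    where
    coprime : Coprime (↧ₙ q) ℤ.∣ ↥ q ∣
    coprime = Coprimality.sym (∣↥∣-coprime-↧ₙ q)

  p^m≤∣↥∣*↧ₙ-/p^ : ∀ m q → ¬ (q /p^ m ℚ.≤ 0ℚ) → p ^ m ≤ ℤ.∣ ↥ q ∣ ℕ.* ↧ₙ (q /p^ m)
  p^m≤∣↥∣*↧ₙ-/p^ m q x≰0 = begin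
    p ^ m                                       ≤⟨ ℕ.m≤n*m (p ^ m) (↧ₙ q) ⟩
    ↧ₙ q ℕ.* p ^ m                              ≤⟨ ℕ.m≤n*m _ _ {{ℕ.>-nonZero (pos⇒∣↥∣>0 x≰0)}} ⟩
    ℤ.∣ ↥ (q /p^ m) ∣ ℕ.* (↧ₙ q ℕ.* p ^ m)      ≡⟨ ∣↥∣-/p^ m q ⟩
    ℤ.∣ ↥ q ∣ ℕ.* ↧ₙ (q /p^ m)                  ∎
    where open ℕ.≤-Reasoning

  -- The positive exponent q/pᵐ has denominator at least pᵐ/|↥ q|, so it eventually leaves
  -- every set of exponents with bounded denominator.
  ↧ₙ-/p^-∤ : 1 < p → ∀ k m q → ℤ.∣ ↥ q ∣ ℕ.* suc k ≤ m → ¬ (q /p^ m ℚ.≤ 0ℚ) → ¬ (↧ₙ (q /p^ m) ∣ suc k)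
  ↧ₙ-/p^-∤ 1<p k m q N≤m x≰0 x∣k = ℕ.<-irrefl ≡.refl (begin-strict
    m                              <⟨ n<m^n 1<p m ⟩
    p ^ m                          ≤⟨ p^m≤∣↥∣*↧ₙ-/p^ m q x≰0 ⟩
    ℤ.∣ ↥ q ∣ ℕ.* ↧ₙ (q /p^ m)     ≤⟨ ℕ.*-monoʳ-≤ ℤ.∣ ↥ q ∣ (∣⇒≤ x∣k) ⟩
    ℤ.∣ ↥ q ∣ ℕ.* suc k            ≤⟨ N≤m ⟩
    m                              ∎)
    where open ℕ.≤-Reasoning

  /p^-nonPos : ∀ m {q} → q ℚ.≤ 0ℚ → q /p^ m ℚ.≤ 0ℚ
  /p^-nonPos zero    q≤0 = q≤0
  /p^-nonPos (suc m) q≤0 = /p^-nonPos m (ℚₚ.≤-trans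
    (ℚₚ.*-monoʳ-≤-nonNeg (+ 1 ℚ./ p) {{ℚₚ.normalize-nonNeg 1 p}} q≤0)
    (ℚₚ.≤-reflexive (ℚₚ.*-zeroˡ (+ 1 ℚ./ p))))

-- approx n q unrolls x q = F q (x (σ q)) n times from 0ₛ; once F is inert along the rest of the
-- σ-orbit of q the unrolling stabilises, and its limit solves the recurrence.
module IteratedRecurrence {a ℓ i} (S : Setoid a ℓ) {I : Set i} (σ : I → I)
  (F : I → Setoid.Carrier S → Setoid.Carrier S) (0ₛ : Setoid.Carrier S)
  (F-cong : ∀ q {x y} → Setoid._≈_ S x y → Setoid._≈_ S (F q x) (F q y)) where

  open Setoid S
  open import Relation.Binary.Reasoning.Setoid S

  Inert : I → Set ℓ
  Inert q = F q 0ₛ ≈ 0ₛ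

  InertFrom : ℕ → I → Set ℓ
  InertFrom n q = ∀ m → n ≤ m → Inert (iterate σ q m)

  approx : ℕ → I → Carrier
  approx zero    q = 0ₛ
  approx (suc n) q = F q (approx n (σ q))

  approx-inert : ∀ n q → InertFrom 0 q → approx n q ≈ 0ₛ
  approx-inert zero    q inert = refl
  approx-inert (suc n) q inert =
    trans (F-cong q (approx-inert n (σ q) (λ m _ → inert (suc m) z≤n))) (inert 0 z≤n)

  approx-stable : ∀ n q → InertFrom n q → ∀ m → n ≤ m → approx m q ≈ approx n q
  approx-stable zero    q inert m       _         = approx-inert m q inert
  approx-stable (suc n) q inert (suc m) (s≤s n≤m) =
    F-cong q (approx-stable n (σ q) (λ k n≤k → inert (suc k) (s≤s n≤k)) m n≤m)

  module Solution (N : I → ℕ) (inert-from-N : ∀ q → InertFrom (N q) q) where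

    solution : I → Carrier
    solution q = approx (N q) q

    solution-fixed : ∀ q → solution q ≈ F q (solution (σ q))
    solution-fixed q = begin
      approx (N q) q                  ≈⟨ approx-stable (N q) q (inert-from-N q) (suc (N q ℕ.+ N σq))
                                           (ℕ.m≤n⇒m≤1+n (ℕ.m≤m+n (N q) (N σq))) ⟨
      F q (approx (N q ℕ.+ N σq) σq)  ≈⟨ F-cong q (approx-stable (N σq) σq (inert-from-N σq) _ (ℕ.m≤n+m (N σq) (N q))) ⟩
      F q (approx (N σq) σq)          ∎
      where σq = σ q

    solution-inert : ∀ q → InertFrom 0 q → solution q ≈ 0ₛ
    solution-inert q = approx-inert (N q) q

module MatrixAlgebra {c ℓ} (R : Semiring c ℓ) where

  open Semiring R
  open SemiringSum R
    using (sum-syntax; sum-cong-≋; sum-replicate-zero; ∑-comm; *-distribˡ-sum; *-distribʳ-sum)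

  infix  4 _≋_
  infixl 7 _·_
  infixl 6 _⊕_

  Matrix : ℕ → ℕ → Set c
  Matrix m n = Fin m → Fin n → Carrier

  ≋-setoid : ℕ → ℕ → Setoid c ℓ
  ≋-setoid m n = VecEquality.≋-setoid (VecEquality.≋-setoid setoid n) m

  _≋_ : ∀ {m n} → Matrix m n → Matrix m n → Set ℓ
  _≋_ {m} {n} = Setoid._≈_ (≋-setoid m n)

  𝟘 : ∀ {m n} → Matrix m n
  𝟘 _ _ = 0#

  _⊕_ : ∀ {m n} → Matrix m n → Matrix m n → Matrix m n
  (A ⊕ B) i j = A i j + B i j

  _·_ : ∀ {m n k} → Matrix m n → Matrix n k → Matrix m k
  _·_ {n = n} A B i j = ∑[ l < n ] (A i l * B l j)

  ·-congˡ : ∀ {m n k} (A : Matrix m n) {X Y : Matrix n k} → X ≋ Y → A · X ≋ A · Y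
  ·-congˡ A X≋Y i j = sum-cong-≋ (λ l → *-congˡ (X≋Y l j))

  ·-congʳ : ∀ {m n k} {A B : Matrix m n} (X : Matrix n k) → A ≋ B → A · X ≋ B · X
  ·-congʳ X A≋B i j = sum-cong-≋ (λ l → *-congʳ (A≋B i l))

  ·-zeroˡ : ∀ {m n k} (X : Matrix n k) → 𝟘 {m} · X ≋ 𝟘
  ·-zeroˡ {n = n} X i j = trans (sum-cong-≋ (λ l → zeroˡ (X l j))) (sum-replicate-zero n)

  ·-zeroʳ : ∀ {m n k} (A : Matrix m n) → A · 𝟘 {n = k} ≋ 𝟘
  ·-zeroʳ {n = n} A i j = trans (sum-cong-≋ (λ l → zeroʳ (A i l))) (sum-replicate-zero n)

  ·-assoc : ∀ {m n k r} (A : Matrix m n) (B : Matrix n k) (C : Matrix k r) → (A · B) · C ≋ A · (B · C)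
  ·-assoc {n = n} {k} A B C i j = begin
    ∑[ l < k ] ((∑[ t < n ] (A i t * B t l)) * C l j)
      ≈⟨ sum-cong-≋ {k} (λ l → *-distribʳ-sum (C l j) (λ t → A i t * B t l)) ⟩
    ∑[ l < k ] ∑[ t < n ] (A i t * B t l * C l j)
      ≈⟨ ∑-comm {k} {n} (λ l t → A i t * B t l * C l j) ⟩
    ∑[ t < n ] ∑[ l < k ] (A i t * B t l * C l j)
      ≈⟨ sum-cong-≋ {n} (λ t → sum-cong-≋ {k} (λ l → *-assoc (A i t) (B t l) (C l j))) ⟩
    ∑[ t < n ] ∑[ l < k ] (A i t * (B t l * C l j))
      ≈⟨ sum-cong-≋ {n} (λ t → *-distribˡ-sum (A i t) (λ l → B t l * C l j)) ⟨
    ∑[ t < n ] (A i t * ∑[ l < k ] (B t l * C l j))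
      ∎
    where open import Relation.Binary.Reasoning.Setoid setoid

module _ {c ℓ} (K : AlgebraicClosureOfℚ c ℓ) where

  open AlgebraicClosureOfℚ K hiding (zero)
  open Over K
  open MatrixAlgebra semiring
  open SemiringSum semiring using (sum; sum-remove; sum-cong-≋; sum-replicate-zero)
  open GroupProperties +-group using (//-rightDividesʳ)

  Σ≡sum : ∀ n (f : Fin n → Carrier) → Σ[ n ] f ≡ sum f
  Σ≡sum zero    f = ≡.refl
  Σ≡sum (suc n) f = cong (_+_ (f zero)) (Σ≡sum n (f ∘ suc))

  δ-diag : ∀ {n} (i : Fin n) → δ i i ≈ 1#
  δ-diag i with i ≟ i
  ... | yes _   = refl
  ... | no i≢i = contradiction ≡.refl i≢i

  δ-offDiag : ∀ {n} {i j : Fin n} → i ≢ j → δ i j ≈ 0#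
  δ-offDiag {i = i} {j} i≢j with i ≟ j
  ... | yes i≡j = contradiction i≡j i≢j
  ... | no _    = refl

  δ-· : ∀ {m n} (X : Matrix m n) → δ · X ≋ X
  δ-· {suc m} X i j = begin
    sum (λ l → δ i l * X l j)
      ≈⟨ sum-remove {i = i} (λ l → δ i l * X l j) ⟩
    δ i i * X i j + sum (λ l → δ i (punchIn i l) * X (punchIn i l) j)
      ≈⟨ +-cong (trans (*-congʳ (δ-diag i)) (*-identityˡ (X i j)))
                (trans (sum-cong-≋ {m} (λ l → trans (*-congʳ (δ-offDiag (punchInᵢ≢i i l ∘ ≡.sym))) (zeroˡ _)))
                       (sum-replicate-zero m)) ⟩
    X i j + 0#                                                    ≈⟨ +-identityʳ (X i j) ⟩
    X i j                                                         ∎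
    where open import Relation.Binary.Reasoning.Setoid setoid

  invertible⇒rightInverse : ∀ {n} {C : Mat n n} → IsInvertible C → ∃ λ D → C · D ≋ δ
  invertible⇒rightInverse {n} {C} (D , C·D≈δ , _) =
    D , λ i j → trans (reflexive (≡.sym (Σ≡sum n (λ l → C i l * D l j)))) (C·D≈δ i j)

  ·-cancel-rightInverse : ∀ {m n} {C D : Matrix m m} → C · D ≋ δ → (W : Matrix m n) → C · (D · W) ≋ W
  ·-cancel-rightInverse {C = C} {D} C·D≋δ W i j =
    trans (sym (·-assoc C D W i j)) (trans (·-congʳ W C·D≋δ i j) (δ-· W i j))

  common-ramification : ∀ {m n} (f : Fin m → Fin n → Coeffs) → (∀ i j → IsPuiseux (f i j)) →
                        ∃ λ k → ∀ i j q → ¬ (↧ₙ q ∣ suc k) → f i j q ≈ 0#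
  common-ramification {m} {n} f f-puiseux = proj₁ all , λ i j q q∤k →
    proj₂ (proj₁ (f-puiseux i j)) q (q∤k ∘ λ q∣kᵢⱼ → ∣-trans q∣kᵢⱼ (∣-trans (proj₂ (row i) j) (proj₂ all i)))
    where
    kᵢⱼ : Fin m → Fin n → ℕ
    kᵢⱼ i j = proj₁ (proj₁ (f-puiseux i j))

    row : ∀ i → ∃ λ K → ∀ j → suc (kᵢⱼ i j) ∣ suc K
    row i = common-multiple (kᵢⱼ i)

    all : ∃ λ K → ∀ i → suc (proj₁ (row i)) ∣ suc K
    all = common-multiple (proj₁ ∘ row)

  module TwistedEquation (p : ℕ) .{{_ : NonZero p}} (1<p : 1 < p) {d₁ d₂ : ℕ}
    (C₁ D₁ : Matrix d₁ d₁) (C₁·D₁≋δ : C₁ · D₁ ≋ δ) (C₂ : Matrix d₂ d₂)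
    (B : Fin d₁ → Fin d₂ → Coeffs) (k : ℕ)
    (B-ramified : ∀ i j q → ¬ (↧ₙ q ∣ suc k) → B i j q ≈ 0#)
    (B-posVal : ∀ i j → PosVal (B i j)) where

    open DivisionByPower p

    B[_] : ℚ → Matrix d₁ d₂
    B[ q ] i j = B i j q

    step : ℚ → Matrix d₁ d₂ → Matrix d₁ d₂
    step q X = D₁ · (B[ q ] ⊕ X · C₂)

    step-cong : ∀ q {X Y} → X ≋ Y → step q X ≋ step q Y
    step-cong q X≋Y = ·-congˡ D₁ (λ i j → +-congˡ (·-congʳ C₂ X≋Y i j))

    open IteratedRecurrence (≋-setoid d₁ d₂) _/p step 𝟘 step-cong

    B≋𝟘⇒inert : ∀ {q} → B[ q ] ≋ 𝟘 → Inert q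
    B≋𝟘⇒inert B≋𝟘 i j = trans
      (·-congˡ D₁ (λ i′ j′ → trans (+-cong (B≋𝟘 i′ j′) (·-zeroˡ C₂ i′ j′)) (+-identityʳ 0#)) i j)
      (·-zeroʳ D₁ i j)

    inert-from-N : ∀ q → InertFrom (ℤ.∣ ↥ q ∣ ℕ.* suc k) q
    inert-from-N q m N≤m = B≋𝟘⇒inert λ i j → vanishes i j
      where
      vanishes : ∀ i j → B i j (q /p^ m) ≈ 0#
      vanishes i j with q /p^ m ℚₚ.≤? 0ℚ
      ... | yes x≤0 = B-posVal i j _ x≤0
      ... | no  x≰0 = B-ramified i j _ (↧ₙ-/p^-∤ 1<p k m q N≤m x≰0)

    open Solution (λ q → ℤ.∣ ↥ q ∣ ℕ.* suc k) inert-from-N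

    M : Fin d₁ → Fin d₂ → Coeffs
    M i j q = solution q i j

    M-solves : ∀ i j q → twisted p C₁ C₂ M i j q ≈ B i j q
    M-solves i j q = begin
      Σ[ d₁ ] (λ l → C₁ i l * M l j q) - Σ[ d₂ ] (λ l → M i l (q /p) * C₂ l j)
        ≡⟨ ≡.cong₂ _-_ (Σ≡sum d₁ (λ l → C₁ i l * M l j q)) (Σ≡sum d₂ (λ l → M i l (q /p) * C₂ l j)) ⟩
      (C₁ · solution q) i j - Y i j           ≈⟨ +-congʳ (·-congˡ C₁ (solution-fixed q) i j) ⟩
      (C₁ · (D₁ · (B[ q ] ⊕ Y))) i j - Y i j  ≈⟨ +-congʳ (·-cancel-rightInverse C₁·D₁≋δ (B[ q ] ⊕ Y) i j) ⟩
      (B i j q + Y i j) - Y i j               ≈⟨ //-rightDividesʳ (Y i j) (B i j q) ⟩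
      B i j q                                 ∎
      where
      open import Relation.Binary.Reasoning.Setoid setoid
      Y = solution (q /p) · C₂

    M-isPuiseux : ∀ i j → IsPuiseux (M i j)
    M-isPuiseux i j =
        (k , λ q q∤k → solution-inert q (λ m _ → B≋𝟘⇒inert λ i′ j′ →
               B-ramified i′ j′ _ (q∤k ∘ ∣-trans (↧ₙ∣↧ₙ-/p^ m q))) i j)
      , (0ℚ , λ q q<0 → solution-inert q (λ m _ → B≋𝟘⇒inert λ i′ j′ →
               B-posVal i′ j′ _ (/p^-nonPos m (ℚₚ.<⇒≤ q<0))) i j)

lemma4p6 : ∀ {c ℓ} (K : AlgebraicClosureOfℚ c ℓ) (p : ℕ) .{{_ : NonZero p}} → 2 ≤ p →
    (d₁ d₂ : ℕ) → 1 ≤ d₁ → 1 ≤ d₂ →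
    (C₁ : Over.Mat K d₁ d₁) → Over.IsInvertible K C₁ →
    (C₂ : Over.Mat K d₂ d₂) → Over.IsInvertible K C₂ →
    (B : Fin d₁ → Fin d₂ → Over.Coeffs K) →
    (∀ i j → Over.IsPuiseux K (B i j)) → (∀ i j → Over.PosVal K (B i j)) →
    ∃ λ (M : Fin d₁ → Fin d₂ → Over.Coeffs K) →
        (∀ i j → Over.IsPuiseux K (M i j))
      × (∀ i j q → AlgebraicClosureOfℚ._≈_ K (Over.twisted K p C₁ C₂ M i j q) (B i j q))
lemma4p6 K p 2≤p d₁ d₂ _ _ C₁ C₁-invertible C₂ _ B B-puiseux B-posVal
  with invertible⇒rightInverse K C₁-invertible | common-ramification K B B-puiseux
... | D₁ , C₁·D₁≋δ | k , B-ramified = M , M-isPuiseux , M-solves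
  where open TwistedEquation K p 2≤p C₁ D₁ C₁·D₁≋δ C₂ B k B-ramified B-posVal
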